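{- For a connected cubic graph $G$ the following statements are equivalent: (a) $G$ is bipartite; (b) $1$ is an eigenvalue of the truncation $T(G)$; (c) $1$ is a simple eigenvalue of $T(G)$.
   Context: The truncation $T(G)$ of a cubic (multi)graph $G$ is the cubic graph obtained by replacing every vertex $v$ of $G$ by a triangle whose three vertices correspond to the three edge-ends at $v$, and for every edge $uv$ of $G$ adding an edge between the corresponding vertices of the triangles of $u$ and $v$ (equivalently, $T(G)$ is the line graph of the subdivision of $G$). Eigenvalues are those of the adjacency matrix; simple means one-dimensional eigenspace.
   Formalization: Eigenvectors of $T(G)$, both for 1 being an eigenvalue in (b) and for the one-dimensionality of its eigenspace in (c), have rational entries rather than real ones. -}

module Defs where

open import Data.Nat using (ℕ; zero; suc)
open import Data.Fin using (Fin; zero; suc)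
open import Data.Fin.Properties using () renaming (_≟_ to _≟F_)
open import Data.Bool using (Bool)
open import Data.Product using (_×_; _,_; proj₁; proj₂; Σ; ∃)
open import Data.Product.Properties using (≡-dec)
open import Data.Rational using (ℚ; 0ℚ; 1ℚ; _+_; _*_)
open import Relation.Nullary using (¬_; Dec; yes; no)
open import Relation.Binary.PropositionalEquality using (_≡_; _≢_)
open import Relation.Binary.Construct.Closure.ReflexiveTransitive using (Star)

-- Cubic multigraphs, encoded by edge-ends ("darts").  The edges are given by a fixed-point-free
-- involution σ on the edge-ends pairing the two ends of each edge.
-- Parallel edges are allowed; loops are excluded (the two ends of an
-- edge lie at different vertices).

Dart : ℕ → Set
Dart n = Fin n × Fin 3

_≟D_ : ∀ {n} (d e : Dart n) → Dec (d ≡ e)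
_≟D_ = ≡-dec _≟F_ _≟F_

record CubicGraph (n : ℕ) : Set where
  field
    σ         : Dart n → Dart n
    involutive : ∀ d → σ (σ d) ≡ d
    loopless  : ∀ d → proj₁ (σ d) ≢ proj₁ d

open CubicGraph public

Adj : ∀ {n} → CubicGraph n → Fin n → Fin n → Set
Adj G u w = Σ (Fin 3) λ i → proj₁ (σ G (u , i)) ≡ w

Connected : ∀ {n} → CubicGraph n → Set
Connected {n} G = ∀ (u w : Fin n) → Star (Adj G) u w

Bipartite : ∀ {n} → CubicGraph n → Set
Bipartite {n} G = Σ (Fin n → Bool) λ c →
  ∀ (d : Dart n) → c (proj₁ d) ≢ c (proj₁ (σ G d))

-- The truncation T(G): its vertices are the darts of G.
-- (v , i) and (v , j) with i ≠ j are joined (the triangle at v), and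
-- d is joined to σ d (the edge of G).

indicator : ∀ {A : Set} → Dec A → ℚ
indicator (yes _) = 1ℚ
indicator (no _)  = 0ℚ

sameVertexDistinctSlot : ∀ {n} (d e : Dart n) → Dec (proj₁ d ≡ proj₁ e × ¬ (proj₂ d ≡ proj₂ e))
sameVertexDistinctSlot (v , i) (w , j) with v ≟F w | i ≟F j
... | yes p | yes q = no λ { (_ , r) → r q }
... | yes p | no q  = yes (p , q)
... | no p  | _     = no λ { (r , _) → p r }

truncAdj : ∀ {n} → CubicGraph n → Dart n → Dart n → ℚ
truncAdj G d e = indicator (sameVertexDistinctSlot d e) + indicator (σ G d ≟D e)

sumFin : ∀ {m} → (Fin m → ℚ) → ℚ
sumFin {zero}  f = 0ℚ
sumFin {suc m} f = f zero + sumFin (λ i → f (suc i))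

sumDart : ∀ {n} → (Dart n → ℚ) → ℚ
sumDart f = sumFin λ v → sumFin λ i → f (v , i)

Vector : ℕ → Set
Vector n = Dart n → ℚ

InEigenspace : ∀ {n} → CubicGraph n → ℚ → Vector n → Set
InEigenspace G λ' x = ∀ d → sumDart (λ e → truncAdj G d e * x e) ≡ λ' * x d

NonZero : ∀ {n} → Vector n → Set
NonZero x = ∃ λ e → x e ≢ 0ℚ

IsEigenvalue : ∀ {n} → CubicGraph n → ℚ → Set
IsEigenvalue G λ' = ∃ λ x → NonZero x × InEigenspace G λ' x

IsSimpleEigenvalue : ∀ {n} → CubicGraph n → ℚ → Set
IsSimpleEigenvalue G λ' = ∃ λ x → NonZero x × InEigenspace G λ' x ×
  (∀ y → InEigenspace G λ' y → ∃ λ c → ∀ e → y e ≡ c * x e)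

-- Let x be an eigenvector of T(G) for 1 and S v the sum of x over the triangle at v. The row of
-- the dart d = (v , i) reads S v - x d + x (σ d) = x d; combining it with the row of σ d gives
-- 3 x d = 2 S v + S w along the edge vw, and summing over the triangle shows that S is an
-- eigenfunction of G for -3, the least eigenvalue of a cubic graph. On a connected graph such an
-- eigenfunction is negated along every edge (compare with its maximum), hence 3 x d = S v.
-- So x ≠ 0 forces S to vanish nowhere and its sign is a proper 2-colouring, and two eigenvectors
-- are proportional because their vertex sums are. Conversely, ±1 on the triangles of the two
-- colour classes is an eigenvector.

module Submission where

open import Defs
open import Data.Nat using (ℕ; zero; suc; _≤_)
open import Data.Fin using (Fin; zero; suc)
open import Data.Fin.Properties using (suc-injective) renaming (_≟_ to _≟F_)
open import Data.Bool using (Bool; true; false)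
import Data.Integer as ℤ
open import Data.Product using (_×_; _,_; proj₁; proj₂)
open import Data.Sum using (_⊎_; inj₁; inj₂)
open import Data.Empty using (⊥-elim)
open import Data.List using (allFin)
open import Data.List.Relation.Unary.All using (lookup)
open import Data.List.Membership.Propositional.Properties using (∈-allFin)
open import Data.Rational using (ℚ; 0ℚ; 1ℚ; _+_; _*_; -_; _-_; _÷_; _/_; 1/_; _<_; Positive; ≢-nonZero)
  renaming (_≤_ to _≤ℚ_)
open import Data.Rational.Properties
  using (+-0-group; ≤-decTotalOrder; _<?_; <-cmp; <-irrefl; <-asym; ≤-antisym; ≤-reflexive; ≮⇒≥;
         +-mono-≤; +-mono-<-≤; <-≤-trans; neg-antimono-<; neg-antimono-≤; neg-distrib-+; neg-distribʳ-*;
         +-identityˡ; +-identityʳ; +-inverseʳ; +-comm; *-identityˡ; *-identityʳ; *-zeroˡ; *-inverseʳ;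
         *-cancelˡ-≤-pos)
open import Data.Rational.Solver using (module +-*-Solver)
open import Algebra.Properties.Group +-0-group
  using () renaming (⁻¹-involutive to neg-involutive; x∙y⁻¹≈ε⇒x≈y to p-q≡0⇒p≡q)
open import Relation.Nullary using (¬_; Dec; yes; no; does)
open import Relation.Binary.PropositionalEquality
open import Relation.Binary.Definitions using (tri<; tri≈; tri>)
open import Relation.Binary.Construct.Closure.ReflexiveTransitive using (Star; ε; _◅_)
open import Function.Bundles using (_⇔_; mk⇔)
open import Function using (_∘_)
open import Relation.Binary.Bundles using (DecTotalOrder)
import Data.List.Extrema (DecTotalOrder.totalOrder ≤-decTotalOrder) as Extrema

open +-*-Solver

private
  variable
    n m : ℕ

3ℚ : ℚ
3ℚ = ℤ.+ 3 / 1

*-cancelˡ-≡-pos : ∀ r .{{_ : Positive r}} {p q : ℚ} → r * p ≡ r * q → p ≡ q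
*-cancelˡ-≡-pos r eq =
  ≤-antisym (*-cancelˡ-≤-pos r (≤-reflexive eq)) (*-cancelˡ-≤-pos r (≤-reflexive (sym eq)))

+-tightˡ : ∀ {a a′ b b′ : ℚ} → a ≤ℚ a′ → b ≤ℚ b′ → a + b ≡ a′ + b′ → a ≡ a′
+-tightˡ {a} {a′} a≤a′ b≤b′ eq with <-cmp a a′
... | tri< a<a′ _ _ = ⊥-elim (<-irrefl eq (+-mono-<-≤ a<a′ b≤b′))
... | tri≈ _ a≡a′ _ = a≡a′
... | tri> _ _ a>a′ = ⊥-elim (<-irrefl refl (<-≤-trans a>a′ a≤a′))

+-tightʳ : ∀ {a a′ b b′ : ℚ} → a ≤ℚ a′ → b ≤ℚ b′ → a + b ≡ a′ + b′ → b ≡ b′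
+-tightʳ {a} {a′} {b} {b′} a≤a′ b≤b′ eq =
  +-tightˡ b≤b′ a≤a′ (trans (+-comm b a) (trans eq (+-comm a′ b′)))

positive? : ℚ → Bool
positive? p = does (0ℚ <? p)

positive?-neg : ∀ {p} → p ≢ 0ℚ → positive? (- p) ≢ positive? p
positive?-neg {p} p≢0 = differ (0ℚ <? - p) (0ℚ <? p)
  where
  differ : (a : Dec (0ℚ < - p)) (b : Dec (0ℚ < p)) → does a ≢ does b
  differ (yes 0<-p) (yes 0<p) _  = <-asym 0<-p (neg-antimono-< 0<p)
  differ (yes _)    (no _)    ()
  differ (no _)     (yes _)   ()
  differ (no 0≮-p)  (no 0≮p)  _  =
    p≢0 (≤-antisym (≮⇒≥ 0≮p) (subst (0ℚ ≤ℚ_) (neg-involutive p) (neg-antimono-≤ (≮⇒≥ 0≮-p))))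

thrice-from-doubles : ∀ {a b s t : ℚ} → a + a ≡ s + b → b + b ≡ t + a → 3ℚ * a ≡ s + s + t
thrice-from-doubles {a} {b} {s} {t} 2a≡s+b 2b≡t+a = begin
  3ℚ * a                ≡⟨ solve 1 (λ a → con 3ℚ :* a := a :+ a :+ (a :+ a) :- a) refl a ⟩
  a + a + (a + a) - a   ≡⟨ cong (λ u → u + u - a) 2a≡s+b ⟩
  s + b + (s + b) - a   ≡⟨ solve 3 (λ a b s → s :+ b :+ (s :+ b) :- a := s :+ s :+ (b :+ b) :- a) refl a b s ⟩
  s + s + (b + b) - a   ≡⟨ cong (λ u → s + s + u - a) 2b≡t+a ⟩
  s + s + (t + a) - a   ≡⟨ solve 3 (λ a s t → s :+ s :+ (t :+ a) :- a := s :+ s :+ t) refl a s t ⟩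
  s + s + t             ∎
  where open ≡-Reasoning

a*d≡c*b⇒a≡c÷d*b : ∀ {a b c d : ℚ} .{{_ : Data.Rational.NonZero d}} → a * d ≡ c * b → a ≡ (c ÷ d) * b
a*d≡c*b⇒a≡c÷d*b {a} {b} {c} {d} eq = begin
  a                     ≡⟨ *-identityʳ a ⟨
  a * 1ℚ                ≡⟨ cong (a *_) (*-inverseʳ d) ⟨
  a * (d * 1/ d)        ≡⟨ solve 3 (λ a d e → a :* (d :* e) := a :* d :* e) refl a d (1/ d) ⟩
  a * d * 1/ d          ≡⟨ cong (_* 1/ d) eq ⟩
  c * b * 1/ d          ≡⟨ solve 3 (λ b c e → c :* b :* e := c :* e :* b) refl b c (1/ d) ⟩
  c * 1/ d * b          ∎
  where open ≡-Reasoning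

indicator-yes : ∀ {A : Set} (p : Dec A) → A → indicator p ≡ 1ℚ
indicator-yes (yes _) _ = refl
indicator-yes (no ¬a) a = ⊥-elim (¬a a)

indicator-no : ∀ {A : Set} (p : Dec A) → ¬ A → indicator p ≡ 0ℚ
indicator-no (yes a) ¬a = ⊥-elim (¬a a)
indicator-no (no _) _ = refl

indicator-no-* : ∀ {A : Set} (p : Dec A) → ¬ A → ∀ a → indicator p * a ≡ 0ℚ
indicator-no-* p ¬a a = trans (cong (_* a) (indicator-no p ¬a)) (*-zeroˡ a)

indicator-yes-* : ∀ {A : Set} (p : Dec A) → A → ∀ a → indicator p * a ≡ a
indicator-yes-* p a x = trans (cong (_* x) (indicator-yes p a)) (*-identityˡ x)

sumFin-cong : {f g : Fin m → ℚ} → (∀ i → f i ≡ g i) → sumFin f ≡ sumFin g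
sumFin-cong {zero}  f≡g = refl
sumFin-cong {suc m} f≡g = cong₂ _+_ (f≡g zero) (sumFin-cong (λ i → f≡g (suc i)))

sumFin-+ : (f g : Fin m → ℚ) → sumFin (λ i → f i + g i) ≡ sumFin f + sumFin g
sumFin-+ {zero}  f g = refl
sumFin-+ {suc m} f g = begin
  (f zero + g zero) + sumFin (λ i → f (suc i) + g (suc i))
    ≡⟨ cong (f zero + g zero +_) (sumFin-+ (λ i → f (suc i)) (λ i → g (suc i))) ⟩
  (f zero + g zero) + (sumFin (λ i → f (suc i)) + sumFin (λ i → g (suc i)))
    ≡⟨ solve 4 (λ a b s t → (a :+ b) :+ (s :+ t) := (a :+ s) :+ (b :+ t)) refl (f zero) (g zero) _ _ ⟩
  sumFin f + sumFin g ∎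
  where open ≡-Reasoning

sumFin-neg : (f : Fin m → ℚ) → sumFin (λ i → - f i) ≡ - sumFin f
sumFin-neg {zero}  f = refl
sumFin-neg {suc m} f =
  trans (cong (- f zero +_) (sumFin-neg (λ i → f (suc i)))) (sym (neg-distrib-+ (f zero) _))

sumFin-zero : {f : Fin m → ℚ} → (∀ i → f i ≡ 0ℚ) → sumFin f ≡ 0ℚ
sumFin-zero {zero}  f≡0 = refl
sumFin-zero {suc m} f≡0 = cong₂ _+_ (f≡0 zero) (sumFin-zero (λ i → f≡0 (suc i)))

sumFin-single : (f : Fin m → ℚ) (i : Fin m) → (∀ j → j ≢ i → f j ≡ 0ℚ) → sumFin f ≡ f i
sumFin-single f zero others = begin
  f zero + sumFin (λ j → f (suc j)) ≡⟨ cong (f zero +_) (sumFin-zero (λ j → others (suc j) λ ())) ⟩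
  f zero + 0ℚ                       ≡⟨ +-identityʳ (f zero) ⟩
  f zero                            ∎
  where open ≡-Reasoning
sumFin-single f (suc i) others = begin
  f zero + sumFin (λ j → f (suc j))
    ≡⟨ cong₂ _+_ (others zero λ ()) (sumFin-single _ i λ j j≢i → others (suc j) (j≢i ∘ suc-injective)) ⟩
  0ℚ + f (suc i)                    ≡⟨ +-identityˡ (f (suc i)) ⟩
  f (suc i)                         ∎
  where open ≡-Reasoning

sumFin-mono-≤ : {f g : Fin m → ℚ} → (∀ i → f i ≤ℚ g i) → sumFin f ≤ℚ sumFin g
sumFin-mono-≤ {zero}  f≤g = ≤-reflexive refl
sumFin-mono-≤ {suc m} f≤g = +-mono-≤ (f≤g zero) (sumFin-mono-≤ (λ i → f≤g (suc i)))

sumFin-tight : {f g : Fin m → ℚ} → (∀ i → f i ≤ℚ g i) → sumFin f ≡ sumFin g → ∀ i → f i ≡ g i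
sumFin-tight f≤g eq zero    = +-tightˡ (f≤g zero) (sumFin-mono-≤ (λ i → f≤g (suc i))) eq
sumFin-tight f≤g eq (suc i) =
  sumFin-tight (λ j → f≤g (suc j)) (+-tightʳ (f≤g zero) (sumFin-mono-≤ (λ j → f≤g (suc j))) eq) i

sumDart-cong : {f g : Dart n → ℚ} → (∀ e → f e ≡ g e) → sumDart f ≡ sumDart g
sumDart-cong f≡g = sumFin-cong λ v → sumFin-cong λ i → f≡g (v , i)

sumDart-+ : (f g : Dart n → ℚ) → sumDart (λ e → f e + g e) ≡ sumDart f + sumDart g
sumDart-+ f g = trans (sumFin-cong λ v → sumFin-+ (λ i → f (v , i)) (λ i → g (v , i)))
  (sumFin-+ (λ v → sumFin λ i → f (v , i)) (λ v → sumFin λ i → g (v , i)))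

vertexSum : Vector n → Fin n → ℚ
vertexSum x v = sumFin λ i → x (v , i)

sumDart-vertex : (x : Vector n) (v : Fin n) →
  sumDart (λ e → indicator (v ≟F proj₁ e) * x e) ≡ vertexSum x v
sumDart-vertex x v = trans
  (sumFin-single _ v λ w w≢v → sumFin-zero λ i → indicator-no-* (v ≟F w) (w≢v ∘ sym) (x (w , i)))
  (sumFin-cong λ i → indicator-yes-* (v ≟F v) refl (x (v , i)))

sumDart-delta : (x : Vector n) (d : Dart n) → sumDart (λ e → indicator (d ≟D e) * x e) ≡ x d
sumDart-delta x (v , i) = begin
  sumDart (λ e → indicator ((v , i) ≟D e) * x e)
    ≡⟨ sumFin-single _ v (λ w w≢v → sumFin-zero λ j →
         indicator-no-* ((v , i) ≟D (w , j)) (w≢v ∘ sym ∘ cong proj₁) (x (w , j))) ⟩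
  sumFin (λ j → indicator ((v , i) ≟D (v , j)) * x (v , j))
    ≡⟨ sumFin-single _ i (λ j j≢i →
         indicator-no-* ((v , i) ≟D (v , j)) (j≢i ∘ sym ∘ cong proj₂) (x (v , j))) ⟩
  indicator ((v , i) ≟D (v , i)) * x (v , i)
    ≡⟨ indicator-yes-* ((v , i) ≟D (v , i)) refl (x (v , i)) ⟩
  x (v , i) ∎
  where open ≡-Reasoning

triangle+identity : (d e : Dart n) →
  indicator (sameVertexDistinctSlot d e) + indicator (d ≟D e) ≡ indicator (proj₁ d ≟F proj₁ e)
triangle+identity (v , i) (w , j) = by-cases (v ≟F w) (i ≟F j)
  where
  T I V : ℚ
  T = indicator (sameVertexDistinctSlot (v , i) (w , j))
  I = indicator ((v , i) ≟D (w , j))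
  V = indicator (v ≟F w)
  values : ∀ {t i} → T ≡ t → I ≡ i → V ≡ t + i → T + I ≡ V
  values T≡t I≡i V≡t+i = trans (cong₂ _+_ T≡t I≡i) (sym V≡t+i)
  by-cases : Dec (v ≡ w) → Dec (i ≡ j) → T + I ≡ V
  by-cases (no v≢w) _ = values
    (indicator-no (sameVertexDistinctSlot (v , i) (w , j)) (v≢w ∘ proj₁))
    (indicator-no ((v , i) ≟D (w , j)) (v≢w ∘ cong proj₁))
    (indicator-no (v ≟F w) v≢w)
  by-cases (yes v≡w) (yes i≡j) = values
    (indicator-no (sameVertexDistinctSlot (v , i) (w , j)) λ p → proj₂ p i≡j)
    (indicator-yes ((v , i) ≟D (w , j)) (cong₂ _,_ v≡w i≡j))
    (indicator-yes (v ≟F w) v≡w)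
  by-cases (yes v≡w) (no i≢j) = values
    (indicator-yes (sameVertexDistinctSlot (v , i) (w , j)) (v≡w , i≢j))
    (indicator-no ((v , i) ≟D (w , j)) (i≢j ∘ cong proj₂))
    (indicator-yes (v ≟F w) v≡w)

-- A + I, for A the adjacency matrix of T(G), is the block matrix of the triangles plus the
-- permutation matrix of σ.
truncAdj-row : (G : CubicGraph n) (x : Vector n) (d : Dart n) →
  sumDart (λ e → truncAdj G d e * x e) + x d ≡ vertexSum x (proj₁ d) + x (σ G d)
truncAdj-row G x d = begin
  sumDart (λ e → (T e + P e) * x e) + x d
    ≡⟨ cong (sumDart (λ e → (T e + P e) * x e) +_) (sym (sumDart-delta x d)) ⟩
  sumDart (λ e → (T e + P e) * x e) + sumDart (λ e → I e * x e)
    ≡⟨ sym (sumDart-+ (λ e → (T e + P e) * x e) (λ e → I e * x e)) ⟩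
  sumDart (λ e → (T e + P e) * x e + I e * x e)
    ≡⟨ sumDart-cong (λ e →
         solve 4 (λ t p i y → (t :+ p) :* y :+ i :* y := (t :+ i) :* y :+ p :* y) refl (T e) (P e) (I e) (x e)) ⟩
  sumDart (λ e → (T e + I e) * x e + P e * x e)
    ≡⟨ sumDart-+ (λ e → (T e + I e) * x e) (λ e → P e * x e) ⟩
  sumDart (λ e → (T e + I e) * x e) + sumDart (λ e → P e * x e)
    ≡⟨ cong₂ _+_
         (trans (sumDart-cong λ e → cong (_* x e) (triangle+identity d e)) (sumDart-vertex x (proj₁ d)))
         (sumDart-delta x (σ G d)) ⟩
  vertexSum x (proj₁ d) + x (σ G d) ∎
  where
  open ≡-Reasoning
  T I P : Dart _ → ℚ
  T e = indicator (sameVertexDistinctSlot d e)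
  I e = indicator (d ≟D e)
  P e = indicator (σ G d ≟D e)

neighbour : CubicGraph n → Fin n → Fin 3 → Fin n
neighbour G v i = proj₁ (σ G (v , i))

module _ {n} (G : CubicGraph n) where

  IsEigenfunction : ℚ → (Fin n → ℚ) → Set
  IsEigenfunction μ f = ∀ v → sumFin (λ i → f (neighbour G v i)) ≡ μ * f v

  Alternating : (Fin n → ℚ) → Set
  Alternating f = ∀ v i → f (neighbour G v i) ≡ - f v

  AdjInvariant : (Fin n → Set) → Set
  AdjInvariant P = ∀ v i → P v → P (neighbour G v i)

  invariant-along : {P : Fin n → Set} → AdjInvariant P → ∀ {u w} → Star (Adj G) u w → P u → P w
  invariant-along step ε                   p = p
  invariant-along step ((i , refl) ◅ path) p = invariant-along step path (step _ i p)

  eigenfunction-neg : {μ : ℚ} {f : Fin n → ℚ} → IsEigenfunction μ f → IsEigenfunction μ (λ v → - f v)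
  eigenfunction-neg {μ} {f} eig v =
    trans (sumFin-neg (λ i → f (neighbour G v i))) (trans (cong -_ (eig v)) (neg-distribʳ-* μ (f v)))

  module BoundedAbove {f : Fin n → ℚ} (eig : IsEigenfunction (- 3ℚ) f)
                                 {B : ℚ} (f≤B : ∀ w → f w ≤ℚ B) where

    -f≤B : ∀ v → - f v ≤ℚ B
    -f≤B v = *-cancelˡ-≤-pos 3ℚ (begin
      3ℚ * - f v                         ≡⟨ solve 1 (λ a → con 3ℚ :* (:- a) := con (- 3ℚ) :* a) refl (f v) ⟩
      - 3ℚ * f v                         ≡⟨ eig v ⟨
      sumFin (λ i → f (neighbour G v i)) ≤⟨ sumFin-mono-≤ (λ i → f≤B (neighbour G v i)) ⟩
      sumFin {3} (λ _ → B)               ≡⟨ solve 1 (λ b → b :+ (b :+ (b :+ con 0ℚ)) := con 3ℚ :* b) refl B ⟩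
      3ℚ * B                             ∎)
      where open Data.Rational.Properties.≤-Reasoning

    f≡-B⇒f∘neighbour≡B : ∀ v → f v ≡ - B → ∀ i → f (neighbour G v i) ≡ B
    f≡-B⇒f∘neighbour≡B v fv≡-B = sumFin-tight (λ i → f≤B (neighbour G v i)) (begin
      sumFin (λ i → f (neighbour G v i)) ≡⟨ eig v ⟩
      - 3ℚ * f v                         ≡⟨ cong (- 3ℚ *_) fv≡-B ⟩
      - 3ℚ * - B                         ≡⟨ solve 1 (λ b → con (- 3ℚ) :* (:- b) := b :+ (b :+ (b :+ con 0ℚ)))
                                                    refl B ⟩
      sumFin {3} (λ _ → B)               ∎)
      where open ≡-Reasoning

  -- With M = max f, also -f ≤ M, and on the vertices where f = ±M the bounds force the
  -- neighbours to the opposite extreme; connectivity spreads this from a maximum to every vertex.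
  eigenfunction[-3]⇒alternating : Connected G → {f : Fin n → ℚ} →
    IsEigenfunction (- 3ℚ) f → Alternating f
  eigenfunction[-3]⇒alternating conn {f} eig v = flips v (invariant-along stays (conn top v) (inj₁ refl))
    where
    open ≡-Reasoning
    top : Fin n
    top = Extrema.argmax f v (allFin n)
    M : ℚ
    M = f top
    f≤M : ∀ w → f w ≤ℚ M
    f≤M w = lookup (Extrema.f[xs]≤f[argmax] v (allFin n)) (∈-allFin w)
    open BoundedAbove eig f≤M
    module Neg = BoundedAbove (eigenfunction-neg {μ = - 3ℚ} {f} eig) -f≤B
    Extreme : Fin n → Set
    Extreme w = f w ≡ M ⊎ f w ≡ - M
    flips : ∀ w → Extreme w → ∀ i → f (neighbour G w i) ≡ - f w
    flips w (inj₁ fw≡M) i = begin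
      f (neighbour G w i)     ≡⟨ neg-involutive _ ⟨
      - - f (neighbour G w i) ≡⟨ cong -_ (Neg.f≡-B⇒f∘neighbour≡B w (cong -_ fw≡M) i) ⟩
      - M                     ≡⟨ cong -_ fw≡M ⟨
      - f w                   ∎
    flips w (inj₂ fw≡-M) i = begin
      f (neighbour G w i) ≡⟨ f≡-B⇒f∘neighbour≡B w fw≡-M i ⟩
      M                   ≡⟨ neg-involutive M ⟨
      - - M               ≡⟨ cong -_ fw≡-M ⟨
      - f w               ∎
    stays : AdjInvariant Extreme
    stays w i (inj₁ fw≡M)  = inj₂ (trans (flips w (inj₁ fw≡M) i) (cong -_ fw≡M))
    stays w i (inj₂ fw≡-M) =
      inj₁ (trans (flips w (inj₂ fw≡-M) i) (trans (cong -_ fw≡-M) (neg-involutive M)))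

  alternating-zero : Connected G → {f : Fin n → ℚ} → Alternating f → ∀ u → f u ≡ 0ℚ → ∀ w → f w ≡ 0ℚ
  alternating-zero conn alt u fu≡0 w =
    invariant-along (λ v i fv≡0 → trans (alt v i) (cong -_ fv≡0)) (conn u w) fu≡0

  alternating-cross : Connected G → {f g : Fin n → ℚ} → Alternating f → Alternating g →
    ∀ u w → f w * g u ≡ f u * g w
  alternating-cross conn {f} {g} alt-f alt-g u w =
    p-q≡0⇒p≡q _ _ (alternating-zero conn alt-h u (+-inverseʳ (f u * g u)) w)
    where
    h : Fin n → ℚ
    h v = f v * g u - f u * g v
    alt-h : Alternating h
    alt-h v i = begin
      f (neighbour G v i) * g u - f u * g (neighbour G v i)
        ≡⟨ cong₂ (λ a b → a * g u - f u * b) (alt-f v i) (alt-g v i) ⟩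
      - f v * g u - f u * - g v
        ≡⟨ solve 4 (λ a b c d → (:- a) :* b :- c :* (:- d) := :- (a :* b :- c :* d)) refl (f v) (g u) (f u) (g v) ⟩
      - h v ∎
      where open ≡-Reasoning

  alternating⇒bipartite : {f : Fin n → ℚ} → Alternating f → (∀ v → f v ≢ 0ℚ) → Bipartite G
  alternating⇒bipartite {f} alt f≢0 = (λ v → positive? (f v)) , λ where
    (v , i) same → positive?-neg (f≢0 v) (trans (cong positive? (sym (alt v i))) (sym same))

module EigenvectorOfTruncation {n} (G : CubicGraph n) (conn : Connected G)
                               (x : Vector n) (eig : InEigenspace G 1ℚ x) where

  S : Fin n → ℚ
  S = vertexSum x

  eigen-row : ∀ d → x d + x d ≡ S (proj₁ d) + x (σ G d)
  eigen-row d =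
    trans (cong (_+ x d) (trans (sym (*-identityˡ (x d))) (sym (eig d)))) (truncAdj-row G x d)

  edge-equation : ∀ v i → 3ℚ * x (v , i) ≡ S v + S v + S (neighbour G v i)
  edge-equation v i = thrice-from-doubles {x (v , i)} {x (σ G (v , i))} {S v} {S (neighbour G v i)}
    (eigen-row (v , i))
    (trans (eigen-row (σ G (v , i))) (cong (λ e → S (neighbour G v i) + x e) (involutive G (v , i))))

  eigenfunction : IsEigenfunction G (- 3ℚ) S
  eigenfunction v = begin
    sumFin (λ i → S (neighbour G v i))
      ≡⟨ sumFin-cong neighbour-value ⟩
    sumFin (λ i → 3ℚ * x (v , i) - (S v + S v))
      ≡⟨ solve 3 (λ a b c → let s = a :+ (b :+ (c :+ con 0ℚ)); t = s :+ s in
                   (con 3ℚ :* a :- t) :+ ((con 3ℚ :* b :- t) :+ ((con 3ℚ :* c :- t) :+ con 0ℚ)) := con (- 3ℚ) :* s)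
                 refl (x (v , zero)) (x (v , suc zero)) (x (v , suc (suc zero))) ⟩
    - 3ℚ * S v ∎
    where
    open ≡-Reasoning
    neighbour-value : ∀ i → S (neighbour G v i) ≡ 3ℚ * x (v , i) - (S v + S v)
    neighbour-value i = begin
      S (neighbour G v i)
        ≡⟨ solve 2 (λ s t → t := s :+ s :+ t :- (s :+ s)) refl (S v) (S (neighbour G v i)) ⟩
      S v + S v + S (neighbour G v i) - (S v + S v)
        ≡⟨ cong (_- (S v + S v)) (edge-equation v i) ⟨
      3ℚ * x (v , i) - (S v + S v) ∎

  alternating : Alternating G S
  alternating = eigenfunction[-3]⇒alternating G conn eigenfunction

  thrice≡vertexSum : ∀ d → 3ℚ * x d ≡ S (proj₁ d)
  thrice≡vertexSum (v , i) = begin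
    3ℚ * x (v , i)                  ≡⟨ edge-equation v i ⟩
    S v + S v + S (neighbour G v i) ≡⟨ cong (S v + S v +_) (alternating v i) ⟩
    S v + S v + - S v               ≡⟨ solve 1 (λ s → s :+ s :+ (:- s) := s) refl (S v) ⟩
    S v                             ∎
    where open ≡-Reasoning

  vertexSum≢0 : NonZero x → ∀ v → S v ≢ 0ℚ
  vertexSum≢0 (e , xe≢0) v Sv≡0 =
    xe≢0 (*-cancelˡ-≡-pos 3ℚ (trans (thrice≡vertexSum e)
                                    (alternating-zero G conn alternating v Sv≡0 (proj₁ e))))

±1 : Bool → ℚ
±1 true  = 1ℚ
±1 false = - 1ℚ

±1≢0 : ∀ b → ±1 b ≢ 0ℚ
±1≢0 true  ()
±1≢0 false ()

±1-flip : ∀ {b c} → b ≢ c → ±1 c ≡ - ±1 b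
±1-flip {true}  {true}  b≢c = ⊥-elim (b≢c refl)
±1-flip {true}  {false} _   = refl
±1-flip {false} {true}  _   = refl
±1-flip {false} {false} b≢c = ⊥-elim (b≢c refl)

bipartite⇒eigenvalue-1 : (G : CubicGraph n) → Fin n → Bipartite G → IsEigenvalue G 1ℚ
bipartite⇒eigenvalue-1 {n} G v₀ (colour , proper) = x , ((v₀ , zero) , ±1≢0 (colour v₀)) , eigen
  where
  x : Vector n
  x (v , _) = ±1 (colour v)
  eigen : InEigenspace G 1ℚ x
  eigen d@(v , i) = begin
    row                               ≡⟨ solve 2 (λ r a → r := r :+ a :- a) refl row (x d) ⟩
    row + x d - x d                   ≡⟨ cong (_- x d) (truncAdj-row G x d) ⟩
    vertexSum x v + x (σ G d) - x d   ≡⟨ cong (λ b → vertexSum x v + b - x d) (±1-flip (proper d)) ⟩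
    vertexSum x v + - x d - x d       ≡⟨ solve 1 (λ a → a :+ (a :+ (a :+ con 0ℚ)) :+ (:- a) :- a := con 1ℚ :* a)
                                               refl (x d) ⟩
    1ℚ * x d                          ∎
    where
    open ≡-Reasoning
    row : ℚ
    row = sumDart (λ e → truncAdj G d e * x e)

eigenvalue-1⇒bipartite : (G : CubicGraph n) → Connected G → IsEigenvalue G 1ℚ → Bipartite G
eigenvalue-1⇒bipartite G conn (x , x≢0 , eig) = alternating⇒bipartite G alternating (vertexSum≢0 x≢0)
  where open EigenvectorOfTruncation G conn x eig

eigenvalue-1⇒simple : (G : CubicGraph n) → Connected G → IsEigenvalue G 1ℚ → IsSimpleEigenvalue G 1ℚ
eigenvalue-1⇒simple G conn (x , x≢0@((v₀ , _) , _) , eig-x) =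
  x , x≢0 , eig-x , λ y eig-y → ratio y , proportional eig-y
  where
  module X = EigenvectorOfTruncation G conn x eig-x
  instance
    Sx[v₀]≢0 : Data.Rational.NonZero (X.S v₀)
    Sx[v₀]≢0 = ≢-nonZero (X.vertexSum≢0 x≢0 v₀)
  ratio : Vector _ → ℚ
  ratio y = vertexSum y v₀ ÷ X.S v₀
  proportional : ∀ {y} → InEigenspace G 1ℚ y → ∀ e → y e ≡ ratio y * x e
  proportional {y} eig-y (v , i) = *-cancelˡ-≡-pos 3ℚ (begin
    3ℚ * y (v , i)
      ≡⟨ Y.thrice≡vertexSum (v , i) ⟩
    Y.S v
      ≡⟨ a*d≡c*b⇒a≡c÷d*b {Y.S v} {X.S v} {Y.S v₀} (alternating-cross G conn Y.alternating X.alternating v₀ v) ⟩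
    ratio y * X.S v
      ≡⟨ cong (ratio y *_) (X.thrice≡vertexSum (v , i)) ⟨
    ratio y * (3ℚ * x (v , i))
      ≡⟨ solve 2 (λ c a → c :* (con 3ℚ :* a) := con 3ℚ :* (c :* a)) refl (ratio y) (x (v , i)) ⟩
    3ℚ * (ratio y * x (v , i)) ∎)
    where
    open ≡-Reasoning
    module Y = EigenvectorOfTruncation G conn y eig-y

simple⇒eigenvalue : (G : CubicGraph n) {μ : ℚ} → IsSimpleEigenvalue G μ → IsEigenvalue G μ
simple⇒eigenvalue G (x , x≢0 , eig , _) = x , x≢0 , eig

corollary6p3 : ∀ (n : ℕ) (G : CubicGraph n) → 1 ≤ n → Connected G →
    (Bipartite G ⇔ IsEigenvalue G 1ℚ) × (IsEigenvalue G 1ℚ ⇔ IsSimpleEigenvalue G 1ℚ)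
corollary6p3 (suc _) G _ conn =
  mk⇔ (bipartite⇒eigenvalue-1 G zero) (eigenvalue-1⇒bipartite G conn) ,
  mk⇔ (eigenvalue-1⇒simple G conn) (simple⇒eigenvalue G {1ℚ})
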